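{- Let $n\ge 10$. The graph $G(5,n)$ is bipartite with partite sets $X=\{v\equiv 0\pmod 4\}$ and $Y=\{v\equiv 2\pmod 4\}$, and its vertex set can be partitioned into an independent set $I$ and two sets inducing paths $Q_1$ and $Q_2$ such that every vertex of $Q_1$ is adjacent to all vertices of $I$ and all vertices of $Q_2$ lying in the partite set opposite to it, and every vertex of $Q_2$ is adjacent to all vertices of $I$ and all vertices of $Q_1$ lying in the partite set opposite to it; these together with the edges of $Q_1$ and $Q_2$ are all the edges of $G(5,n)$. Moreover, $G(5,1)\cong K_1$, $G(5,2)\cong K_2$, $G(5,3)\cong P_3$, $G(5,4)\cong C_4$, $G(5,5)\cong K_{2,3}$, $G(5,6)\cong K_{3,3}$, $G(5,7)\cong K_{3,4}$, $G(5,8)$ is obtained from $K_{4,4}$ by deleting exactly one edge, and $G(5,9)$ is obtained from $K_{4,5}$ by deleting two disjoint edges.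
   Context: For a prime $p$ and $n\in\mathbb{N}$, $G(p,n)$ is the simple graph with vertex set $\{2,4,\ldots,2n\}$ in which two distinct vertices $a,b$ are adjacent if and only if both $\frac{a+b}{2}$ and $\frac{|a-b|}{2}$ are odd positive integers neither of which equals $pk$ for an integer $k\ge 2$. $P_k$ is the path on $k$ vertices, $C_k$ the cycle on $k$ vertices, $K_{r,s}$ the complete bipartite graph. -}

module Defs where

open import Data.Nat using (ℕ; zero; suc; _+_; _*_; _≤_; _<_; _%_; _≡ᵇ_; _≤ᵇ_; ⌊_/2⌋; ∣_-_∣)
open import Data.Bool using (Bool; true; false; _∧_; T)
open import Data.Fin using (Fin; toℕ)
open import Data.Sum using (_⊎_; inj₁; inj₂)
open import Data.Product using (Σ; _×_; _,_; proj₁; ∃)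
open import Data.Empty using (⊥)
open import Data.Unit using (⊤)
open import Relation.Nullary using (¬_)
open import Relation.Binary.PropositionalEquality using (_≡_; _≢_)
open import Function.Bundles using (_⇔_)

record Graph : Set₁ where
  field
    V : Set
    E : V → V → Set
open Graph public

record _≅_ (G H : Graph) : Set where
  field
    to      : V G → V H
    from    : V H → V G
    from∘to : ∀ x → from (to x) ≡ x
    to∘from : ∀ y → to (from y) ≡ y
    adj     : ∀ x y → E G x y ⇔ E H (to x) (to y)

Induced : (G : Graph) → (V G → Set) → Graph
Induced G S = record
  { V = Σ (V G) S
  ; E = λ x y → E G (proj₁ x) (proj₁ y) }

K1 : Graph
K1 = record { V = Fin 1 ; E = λ _ _ → ⊥ }

K2 : Graph
K2 = record { V = Fin 2 ; E = λ x y → x ≢ y }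

Path : ℕ → Graph
Path k = record { V = Fin k ; E = λ i j → (suc (toℕ i) ≡ toℕ j) ⊎ (suc (toℕ j) ≡ toℕ i) }

C4 : Graph
C4 = record { V = Fin 4
            ; E = λ i j → ((suc (toℕ i)) % 4 ≡ toℕ j) ⊎ ((suc (toℕ j)) % 4 ≡ toℕ i) }

KBipE : (r s : ℕ) → Fin r ⊎ Fin s → Fin r ⊎ Fin s → Set
KBipE r s (inj₁ _) (inj₁ _) = ⊥
KBipE r s (inj₁ _) (inj₂ _) = ⊤
KBipE r s (inj₂ _) (inj₁ _) = ⊤
KBipE r s (inj₂ _) (inj₂ _) = ⊥

KBip : ℕ → ℕ → Graph
KBip r s = record { V = Fin r ⊎ Fin s ; E = KBipE r s }

IsEdgeIJ : {r s : ℕ} → Fin r → Fin s → Fin r ⊎ Fin s → Fin r ⊎ Fin s → Set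
IsEdgeIJ i j x y = (x ≡ inj₁ i × y ≡ inj₂ j) ⊎ (x ≡ inj₂ j × y ≡ inj₁ i)

KBipMinus1 : (r s : ℕ) → Fin r → Fin s → Graph
KBipMinus1 r s i j = record
  { V = Fin r ⊎ Fin s
  ; E = λ x y → KBipE r s x y × ¬ IsEdgeIJ i j x y }

KBipMinus2 : (r s : ℕ) → Fin r → Fin s → Fin r → Fin s → Graph
KBipMinus2 r s i₁ j₁ i₂ j₂ = record
  { V = Fin r ⊎ Fin s
  ; E = λ x y → KBipE r s x y × ¬ IsEdgeIJ i₁ j₁ x y × ¬ IsEdgeIJ i₂ j₂ x y }

Good : ℕ → ℕ → Set
Good p m = (m % 2 ≡ 1) × (0 < m) × ¬ (Σ ℕ λ k → (2 ≤ k) × (m ≡ p * k))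

isVertex : ℕ → ℕ → Bool
isVertex n v = (v % 2 ≡ᵇ 0) ∧ ((2 ≤ᵇ v) ∧ (v ≤ᵇ 2 * n))

GV : ℕ → Set
GV n = Σ ℕ λ v → T (isVertex n v)

-- Adjacency of distinct vertices a, b (both even, so (a+b)/2 and |a-b|/2
-- are the exact halves).
Adj : ℕ → ℕ → ℕ → Set
Adj p a b = (a ≢ b) × Good p ⌊ a + b /2⌋ × Good p ⌊ ∣ a - b ∣ /2⌋

G : ℕ → ℕ → Graph
G p n = record { V = GV n ; E = λ x y → Adj p (proj₁ x) (proj₁ y) }

InX : (n : ℕ) → GV n → Set
InX n x = proj₁ x % 4 ≡ 0

InY : (n : ℕ) → GV n → Set
InY n x = proj₁ x % 4 ≡ 2

Opposite : (n : ℕ) → GV n → GV n → Set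
Opposite n x y = (InX n x × InY n y) ⊎ (InY n x × InX n y)

data Part : Set where
  partI partQ1 partQ2 : Part

InducesPath : (H : Graph) → (V H → Set) → Set
InducesPath H S = Σ ℕ λ k → (1 ≤ k) × (Induced H S ≅ Path k)

Structure : ℕ → Set
Structure n =
  (∀ (x y : GV n) → Adj 5 (proj₁ x) (proj₁ y) → Opposite n x y)
  × (Σ (GV n → Part) λ lab →
        (∀ x y → lab x ≡ partI → lab y ≡ partI → ¬ Adj 5 (proj₁ x) (proj₁ y))
      × InducesPath (G 5 n) (λ x → lab x ≡ partQ1)
      × InducesPath (G 5 n) (λ x → lab x ≡ partQ2)
      -- between different classes (I–Q₁, I–Q₂, Q₁–Q₂): adjacent iff in
      -- opposite partite sets; together with the above this lists all edges
      × (∀ x y → lab x ≢ lab y → (Adj 5 (proj₁ x) (proj₁ y) ⇔ Opposite n x y)))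

{-# OPTIONS --safe #-}
module Submission where

-- Write each vertex 2i through its half i.  Then 2i ~ 2j iff i + j is odd and each of
-- i + j, |i − j| that is divisible by p equals p.  So adjacent halves have opposite parity,
-- which is the bipartition, and halves with i ≢ ±j (mod p) are adjacent iff they have
-- opposite parity.  For p = 5 the classes 0, ±1, ±2 (mod 5) give I, Q₁, Q₂.  Two positive
-- multiples of 5 are never adjacent, as their sum exceeds 5.  In the class ±c (p ∤ 2c), two
-- halves with the same residue are adjacent iff they differ by p, and two halves with
-- opposite residues only if their sum is p, i.e. for the pair (p − c, c).  Hence the class
-- is the path running down through the halves ≡ p − c and then up through the halves ≡ c.
-- For n ≤ 9 the isomorphisms are checked by evaluation.

open import Defs

open import Axiom.UniquenessOfIdentityProofs.WithK using (uip)
open import Data.Bool using (T)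
open import Data.Bool.Properties using (T-∧; T-irrelevant)
open import Data.Empty using (⊥-elim)
open import Data.Fin as Fin using (Fin; #_; toℕ; fromℕ<; opposite; _↑ˡ_; _↑ʳ_)
open import Data.Fin.Properties
  using (all?; toℕ<n; toℕ-fromℕ<; toℕ-injective; opposite-prop; opposite-involutive; +↔⊎; toℕ-↑ˡ; toℕ-↑ʳ)
open import Data.Nat
  using ( ℕ; zero; suc; pred; _+_; _*_; _∸_; _≤_; _<_; _%_; _/_; ⌊_/2⌋; ⌈_/2⌉; ∣_-_∣
        ; z≤n; s≤s; z<s; _≟_; NonZero; >-nonZero)
open import Data.Nat.DivMod
open import Data.Nat.Divisibility
  using (_∣_; divides; _∣?_; n∣m*n; ∣m+n∣m⇒∣n; ∣m∣n⇒∣m+n; ∣⇒≤; m%n≡0⇒n∣m; n∣m⇒m%n≡0)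
open import Data.Nat.Properties
open import Data.Nat.Tactic.RingSolver using (solve-∀)
open import Data.Product using (Σ; _×_; _,_; proj₁; proj₂; swap)
open import Data.Product.Function.NonDependent.Propositional using (_×-⇔_)
open import Data.Sum as Sum using (_⊎_; inj₁; inj₂)
open import Data.Sum.Function.Propositional using (_⊎-⇔_; _⊎-↔_)
open import Data.Sum.Properties using (≡-dec)
open import Data.Unit using (tt)
open import Function.Base using (_∘_)
open import Function.Bundles using (_⇔_; mk⇔; Equivalence; _↔_; Inverse; mk↔ₛ′)
open import Function.Properties.Equivalence
  using () renaming (refl to ⇔-refl; sym to ⇔-sym; trans to ⇔-trans)
open import Function.Properties.Inverse using (↔-refl; ↔-sym; ↔-trans)
open import Relation.Binary.Definitions using (DecidableEquality)
open import Relation.Binary.PropositionalEquality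
  using (_≡_; _≢_; refl; sym; trans; cong; cong₂; subst; subst₂; module ≡-Reasoning)
open import Relation.Nullary using (¬_; Dec; yes; no; ¬?; _×-dec_; _⊎-dec_; _→-dec_; contradiction)
open import Relation.Nullary.Decidable using (map; recompute; T?; True; toWitness; from-no)

open Equivalence using (to; from)

[m+m]%2≡0 : ∀ m → (m + m) % 2 ≡ 0
[m+m]%2≡0 zero    = refl
[m+m]%2≡0 (suc m) = trans (cong (λ k → suc k % 2) (+-suc m m)) ([m+m]%2≡0 m)

odd-+⇒≢ : ∀ {m n} → (m + n) % 2 ≡ 1 → m ≢ n
odd-+⇒≢ {m} odd refl with trans (sym odd) ([m+m]%2≡0 m)
... | ()

∣m-n∣%2≡[m+n]%2 : ∀ m n → ∣ m - n ∣ % 2 ≡ (m + n) % 2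
∣m-n∣%2≡[m+n]%2 zero    n       = refl
∣m-n∣%2≡[m+n]%2 (suc m) zero    = cong (_% 2) (sym (+-identityʳ (suc m)))
∣m-n∣%2≡[m+n]%2 (suc m) (suc n) = trans (∣m-n∣%2≡[m+n]%2 m n) (cong (λ k → suc k % 2) (sym (+-suc m n)))

%2-cases : ∀ m → m % 2 ≡ 0 ⊎ m % 2 ≡ 1
%2-cases zero          = inj₁ refl
%2-cases (suc zero)    = inj₂ refl
%2-cases (suc (suc m)) = %2-cases m

+-%2 : ∀ m n {a b} → m % 2 ≡ a → n % 2 ≡ b → (m + n) % 2 ≡ (a + b) % 2
+-%2 m n refl refl = %-distribˡ-+ m n 2

OppositeParity : ℕ → ℕ → Set
OppositeParity m n = m % 2 ≡ 0 × n % 2 ≡ 1 ⊎ m % 2 ≡ 1 × n % 2 ≡ 0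

odd-+⇔oppositeParity : ∀ m n → (m + n) % 2 ≡ 1 ⇔ OppositeParity m n
odd-+⇔oppositeParity m n = mk⇔ split join
  where
  split : (m + n) % 2 ≡ 1 → OppositeParity m n
  split odd with %2-cases m | %2-cases n
  ... | inj₁ e | inj₂ f = inj₁ (e , f)
  ... | inj₂ e | inj₁ f = inj₂ (e , f)
  ... | inj₁ e | inj₁ f = contradiction (trans (sym odd) (+-%2 m n e f)) λ ()
  ... | inj₂ e | inj₂ f = contradiction (trans (sym odd) (+-%2 m n e f)) λ ()
  join : OppositeParity m n → (m + n) % 2 ≡ 1
  join (inj₁ (e , f)) = +-%2 m n e f
  join (inj₂ (e , f)) = +-%2 m n e f

odd⇒pos : ∀ {m} → m % 2 ≡ 1 → 0 < m
odd⇒pos {suc m} _ = s≤s z≤n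

good-intro : ∀ {p m} → m % 2 ≡ 1 → (p ∣ m → m ≡ p) → Good p m
good-intro {zero} odd _ =
  odd , odd⇒pos odd , λ (_ , _ , m≡0) → contradiction (trans (sym odd) (cong (_% 2) m≡0)) λ ()
good-intro {p@(suc _)} odd p∣⇒≡ = odd , odd⇒pos odd , λ (k , 2≤k , m≡pk) →
  let p*k≡p*1 = trans (sym m≡pk) (trans (p∣⇒≡ (divides k (trans m≡pk (*-comm p k)))) (sym (*-identityʳ p)))
  in <⇒≱ 2≤k (≤-reflexive (*-cancelˡ-≡ k 1 p p*k≡p*1))

good-∣⇒≡ : ∀ {p m} → Good p m → p ∣ m → m ≡ p
good-∣⇒≡ (odd , _ , _) (divides zero m≡0) with trans (sym odd) (cong (_% 2) m≡0)
... | ()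
good-∣⇒≡ {p} _ (divides (suc zero) m≡p) = trans m≡p (+-identityʳ p)
good-∣⇒≡ {p} (_ , _ , notMultiple) (divides (suc (suc k)) m≡kp) =
  contradiction (suc (suc k) , s≤s (s≤s z≤n) , trans m≡kp (*-comm (suc (suc k)) p)) notMultiple

good? : ∀ p m → Dec (Good p m)
good? p m = map (mk⇔ (λ (odd , p∣⇒≡) → good-intro odd p∣⇒≡) (λ g → proj₁ g , good-∣⇒≡ g))
                ((m % 2 ≟ 1) ×-dec (p ∣? m →-dec m ≟ p))

HalfAdj : ℕ → ℕ → ℕ → Set
HalfAdj p i j = i ≢ j × Good p (i + j) × Good p ∣ i - j ∣

halfAdj? : ∀ p i j → Dec (HalfAdj p i j)
halfAdj? p i j = ¬? (i ≟ j) ×-dec good? p (i + j) ×-dec good? p ∣ i - j ∣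

halfAdj-intro : ∀ {p i j} → (i + j) % 2 ≡ 1 → (p ∣ i + j → i + j ≡ p) → (p ∣ ∣ i - j ∣ → ∣ i - j ∣ ≡ p) →
                HalfAdj p i j
halfAdj-intro {i = i} {j} odd p∣sum⇒≡ p∣diff⇒≡ =
  odd-+⇒≢ odd , good-intro odd p∣sum⇒≡ , good-intro (trans (∣m-n∣%2≡[m+n]%2 i j) odd) p∣diff⇒≡

halfAdj-sym : ∀ {p i j} → HalfAdj p i j → HalfAdj p j i
halfAdj-sym {p} {i} {j} (i≢j , g₁ , g₂) =
  (λ j≡i → i≢j (sym j≡i)) , subst (Good p) (+-comm i j) g₁ , subst (Good p) (∣-∣-comm i j) g₂

⌊2*n/2⌋≡n : ∀ n → ⌊ 2 * n /2⌋ ≡ n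
⌊2*n/2⌋≡n n = trans (cong ⌊_/2⌋ (cong (n +_) (+-identityʳ n))) (sym (n≡⌊n+n/2⌋ n))

Adj-double⇔HalfAdj : ∀ p i j → Adj p (2 * i) (2 * j) ⇔ HalfAdj p i j
Adj-double⇔HalfAdj p i j = mk⇔
  (λ (≢ , g₁ , g₂) → ≢ ∘ cong (2 *_) , subst (Good p) sum g₁ , subst (Good p) diff g₂)
  (λ (≢ , g₁ , g₂) → ≢ ∘ *-cancelˡ-≡ i j 2 , subst (Good p) (sym sum) g₁ , subst (Good p) (sym diff) g₂)
  where
  sum : ⌊ 2 * i + 2 * j /2⌋ ≡ i + j
  sum = trans (cong ⌊_/2⌋ (sym (*-distribˡ-+ 2 i j))) (⌊2*n/2⌋≡n (i + j))
  diff : ⌊ ∣ 2 * i - 2 * j ∣ /2⌋ ≡ ∣ i - j ∣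
  diff = trans (cong ⌊_/2⌋ (sym (*-distribˡ-∣-∣ 2 i j))) (⌊2*n/2⌋≡n ∣ i - j ∣)

half : ∀ {A : ℕ → Set} → Σ ℕ A → ℕ
half x = ⌊ proj₁ x /2⌋

even⇒≡2*⌊/2⌋ : ∀ v → v % 2 ≡ 0 → v ≡ 2 * ⌊ v /2⌋
even⇒≡2*⌊/2⌋ zero          _    = refl
even⇒≡2*⌊/2⌋ (suc (suc v)) even =
  cong suc (trans (cong suc (even⇒≡2*⌊/2⌋ v even)) (sym (+-suc ⌊ v /2⌋ (⌊ v /2⌋ + 0))))

module VertexSet (n : ℕ) where

  isVertex⇒ : ∀ v → T (isVertex n v) → v % 2 ≡ 0 × 2 ≤ v × v ≤ 2 * n
  isVertex⇒ v t =
    let (even , bounds) = to T-∧ t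
        (lower , upper) = to T-∧ bounds
    in ≡ᵇ⇒≡ (v % 2) 0 even , ≤ᵇ⇒≤ 2 v lower , ≤ᵇ⇒≤ v (2 * n) upper

  ≡2*half : (x : GV n) → proj₁ x ≡ 2 * half x
  ≡2*half (v , t) = even⇒≡2*⌊/2⌋ v (proj₁ (isVertex⇒ v t))

  half-pos : (x : GV n) → 1 ≤ half x
  half-pos x@(v , t) = *-cancelˡ-≤ 2 (subst (2 ≤_) (≡2*half x) (proj₁ (proj₂ (isVertex⇒ v t))))

  half≤n : (x : GV n) → half x ≤ n
  half≤n x@(v , t) = *-cancelˡ-≤ 2 (subst (_≤ 2 * n) (≡2*half x) (proj₂ (proj₂ (isVertex⇒ v t))))

  vertex : ∀ i → .(1 ≤ i) → .(i ≤ n) → GV n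
  vertex i 1≤i i≤n = 2 * i , recompute (T? (isVertex n (2 * i))) (from T-∧
    ( ≡⇒≡ᵇ _ 0 (trans (cong (_% 2) (*-comm 2 i)) (m*n%n≡0 i 2))
    , from T-∧ (≤⇒≤ᵇ (*-monoʳ-≤ 2 1≤i) , ≤⇒≤ᵇ (*-monoʳ-≤ 2 i≤n))))

  half-injective : ∀ {x y : GV n} → half x ≡ half y → x ≡ y
  half-injective {v , t} {w , u} eq with trans (≡2*half (v , t)) (trans (cong (2 *_) eq) (sym (≡2*half (w , u))))
  ... | refl = cong (v ,_) (T-irrelevant t u)

  Adj⇔HalfAdj : ∀ p (x y : GV n) → Adj p (proj₁ x) (proj₁ y) ⇔ HalfAdj p (half x) (half y)
  Adj⇔HalfAdj p x y =
    subst₂ (λ a b → Adj p a b ⇔ HalfAdj p (half x) (half y)) (sym (≡2*half x)) (sym (≡2*half y))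
           (Adj-double⇔HalfAdj p (half x) (half y))

  vertexIndex : GV n → Fin n
  vertexIndex x = fromℕ< (≤-trans (≤-reflexive (suc-pred (half x) {{>-nonZero (half-pos x)}})) (half≤n x))

  suc-toℕ-vertexIndex : (x : GV n) → suc (toℕ (vertexIndex x)) ≡ half x
  suc-toℕ-vertexIndex x = trans (cong suc (toℕ-fromℕ< _)) (suc-pred (half x) {{>-nonZero (half-pos x)}})

  vertices↔Fin : GV n ↔ Fin n
  vertices↔Fin = mk↔ₛ′ vertexIndex vertexAt vertexIndex-vertexAt vertexAt-vertexIndex
    where
    vertexAt : Fin n → GV n
    vertexAt i = vertex (suc (toℕ i)) (s≤s z≤n) (toℕ<n i)
    vertexIndex-vertexAt : ∀ i → vertexIndex (vertexAt i) ≡ i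
    vertexIndex-vertexAt i = toℕ-injective (trans (toℕ-fromℕ< _) (cong pred (⌊2*n/2⌋≡n (suc (toℕ i)))))
    vertexAt-vertexIndex : ∀ x → vertexAt (vertexIndex x) ≡ x
    vertexAt-vertexIndex x = half-injective (trans (⌊2*n/2⌋≡n _) (suc-toℕ-vertexIndex x))

  %4≡⇔half%2≡ : (x : GV n) (b : ℕ) → proj₁ x % 4 ≡ b * 2 ⇔ half x % 2 ≡ b
  %4≡⇔half%2≡ x b = mk⇔ (λ e → *-cancelʳ-≡ _ b 2 (trans (sym double%4) e)) (λ e → trans double%4 (cong (_* 2) e))
    where
    double%4 : proj₁ x % 4 ≡ half x % 2 * 2
    double%4 = trans (cong (_% 4) (trans (≡2*half x) (*-comm 2 (half x)))) (sym (m%n*o≡m*o%[n*o] (half x) 2 2))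

  Opposite⇔odd : (x y : GV n) → Opposite n x y ⇔ (half x + half y) % 2 ≡ 1
  Opposite⇔odd x y = ⇔-trans ((parity x 0 ×-⇔ parity y 1) ⊎-⇔ (parity x 1 ×-⇔ parity y 0))
                             (⇔-sym (odd-+⇔oppositeParity (half x) (half y)))
    where
    parity : (z : GV n) (b : ℕ) → proj₁ z % 4 ≡ b * 2 ⇔ half z % 2 ≡ b
    parity = %4≡⇔half%2≡

-- Isomorphisms, paths, and two rays joined at their roots

≅-trans : ∀ {G H K} → G ≅ H → H ≅ K → G ≅ K
≅-trans f g = record
  { to      = λ x → g.to (f.to x)
  ; from    = λ z → f.from (g.from z)
  ; from∘to = λ x → trans (cong f.from (g.from∘to (f.to x))) (f.from∘to x)
  ; to∘from = λ z → trans (cong g.to (f.to∘from (g.from z))) (g.to∘from z)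
  ; adj     = λ x y → ⇔-trans (f.adj x y) (g.adj (f.to x) (f.to y))
  }
  where
  module f = _≅_ f
  module g = _≅_ g

relabel : ∀ {G H} (e : V G ↔ V H) → (∀ x y → E G x y ⇔ E H (Inverse.to e x) (Inverse.to e y)) → G ≅ H
relabel e adj = record
  { to      = Inverse.to e
  ; from    = Inverse.from e
  ; from∘to = Inverse.strictlyInverseʳ e
  ; to∘from = Inverse.strictlyInverseˡ e
  ; adj     = adj
  }

≡⇒⇔ : ∀ {A B : Set} → A ≡ B → A ⇔ B
≡⇒⇔ refl = ⇔-refl

Consecutive : ℕ → ℕ → Set
Consecutive m n = suc m ≡ n ⊎ suc n ≡ m

∣-∣≡1⇔consecutive : ∀ m n → ∣ m - n ∣ ≡ 1 ⇔ Consecutive m n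
∣-∣≡1⇔consecutive m n =
  mk⇔ (consecutive m n) Sum.[ (λ { refl → ∣n-1+n∣≡1 m }) , (λ { refl → trans (∣-∣-comm (suc n) n) (∣n-1+n∣≡1 n) }) ]
  where
  consecutive : ∀ m n → ∣ m - n ∣ ≡ 1 → Consecutive m n
  consecutive zero    n       e = inj₁ (sym e)
  consecutive (suc m) zero    e = inj₂ (sym e)
  consecutive (suc m) (suc n) e = Sum.map (cong suc) (cong suc) (consecutive m n e)
  ∣n-1+n∣≡1 : ∀ n → ∣ n - suc n ∣ ≡ 1
  ∣n-1+n∣≡1 zero    = refl
  ∣n-1+n∣≡1 (suc n) = ∣n-1+n∣≡1 n

consecutive-+ˡ : ∀ k {m n} → Consecutive m n ⇔ Consecutive (k + m) (k + n)
consecutive-+ˡ k {m} {n} = mk⇔ (Sum.map (shift m) (shift n)) (Sum.map (unshift m) (unshift n))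
  where
  shift : ∀ a {b} → suc a ≡ b → suc (k + a) ≡ k + b
  shift a refl = sym (+-suc k a)
  unshift : ∀ a {b} → suc (k + a) ≡ k + b → suc a ≡ b
  unshift a e = +-cancelˡ-≡ k _ _ (trans (+-suc k a) e)

consecutive-opposite : ∀ {A} {i j : Fin A} →
                       Consecutive (toℕ i) (toℕ j) → Consecutive (toℕ (opposite i)) (toℕ (opposite j))
consecutive-opposite {A} {i} {j} = Sum.swap ∘ Sum.map (flip i j) (flip j i)
  where
  flip : ∀ (a b : Fin A) → suc (toℕ a) ≡ toℕ b → suc (toℕ (opposite b)) ≡ toℕ (opposite a)
  flip a b e = begin
    suc (toℕ (opposite b))  ≡⟨ cong suc (opposite-prop b) ⟩
    suc (A ∸ suc (toℕ b))   ≡⟨ sym (+-∸-assoc 1 (toℕ<n b)) ⟩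
    A ∸ toℕ b               ≡⟨ cong (A ∸_) (sym e) ⟩
    A ∸ suc (toℕ a)         ≡⟨ sym (opposite-prop a) ⟩
    toℕ (opposite a)        ∎
    where open ≡-Reasoning

consecutive⇔opposite : ∀ {A} (i j : Fin A) →
                       Consecutive (toℕ i) (toℕ j) ⇔ Consecutive (toℕ (opposite i)) (toℕ (opposite j))
consecutive⇔opposite i j = mk⇔ consecutive-opposite λ c →
  subst₂ (λ a b → Consecutive (toℕ a) (toℕ b)) (opposite-involutive i) (opposite-involutive j) (consecutive-opposite c)

consecutive-across : ∀ {A t s} → t < A → Consecutive (A ∸ suc t) (A + s) ⇔ (t ≡ 0 × s ≡ 0)
consecutive-across {A} {t} {s} t<A =
  mk⇔ roots λ { (refl , refl) → inj₁ (trans (sym (+-∸-assoc 1 t<A)) (sym (+-identityʳ A))) }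
  where
  roots : Consecutive (A ∸ suc t) (A + s) → t ≡ 0 × s ≡ 0
  roots (inj₁ e) = t≡0 , s≡0
    where
    A∸t≡A+s : A ∸ t ≡ A + s
    A∸t≡A+s = trans (+-∸-assoc 1 t<A) e
    s≡0 : s ≡ 0
    s≡0 = n≤0⇒n≡0 (+-cancelˡ-≤ A s 0 (subst₂ _≤_ A∸t≡A+s (sym (+-identityʳ A)) (m∸n≤m A t)))
    t≡0 : t ≡ 0
    t≡0 = ∸-cancelˡ-≡ (<⇒≤ t<A) z≤n (trans A∸t≡A+s (trans (cong (A +_) s≡0) (+-identityʳ A)))
  roots (inj₂ e) = contradiction (subst (_≤ A) (sym e) (m∸n≤m A (suc t))) (<⇒≱ (s≤s (m≤m+n A s)))

RaysE : ∀ {A B} → Fin A ⊎ Fin B → Fin A ⊎ Fin B → Set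
RaysE (inj₁ t) (inj₁ s) = Consecutive (toℕ t) (toℕ s)
RaysE (inj₂ t) (inj₂ s) = Consecutive (toℕ t) (toℕ s)
RaysE (inj₁ t) (inj₂ s) = toℕ t ≡ 0 × toℕ s ≡ 0
RaysE (inj₂ t) (inj₁ s) = toℕ t ≡ 0 × toℕ s ≡ 0

Rays : ℕ → ℕ → Graph
Rays A B = record { V = Fin A ⊎ Fin B ; E = RaysE }

opposite-↔ : ∀ {A} → Fin A ↔ Fin A
opposite-↔ = mk↔ₛ′ opposite opposite opposite-involutive opposite-involutive

rays≅path : ∀ A B → Rays A B ≅ Path (A + B)
rays≅path A B = relabel (↔-trans (opposite-↔ ⊎-↔ ↔-refl) (↔-sym +↔⊎)) adj
  where
  left : (t : Fin A) → toℕ (opposite t ↑ˡ B) ≡ A ∸ suc (toℕ t)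
  left t = trans (toℕ-↑ˡ (opposite t) B) (opposite-prop t)
  across : (t : Fin A) (s : Fin B) →
           (toℕ t ≡ 0 × toℕ s ≡ 0) ⇔ Consecutive (toℕ (opposite t ↑ˡ B)) (toℕ (A ↑ʳ s))
  across t s = ⇔-sym (⇔-trans (≡⇒⇔ (cong₂ Consecutive (left t) (toℕ-↑ʳ A s))) (consecutive-across (toℕ<n t)))
  adj : ∀ u w → RaysE u w ⇔ E (Path (A + B)) _ _
  adj (inj₁ t) (inj₁ s) = ⇔-trans (consecutive⇔opposite t s)
    (≡⇒⇔ (cong₂ Consecutive (sym (toℕ-↑ˡ (opposite t) B)) (sym (toℕ-↑ˡ (opposite s) B))))
  adj (inj₂ t) (inj₂ s) = ⇔-trans (consecutive-+ˡ A) (≡⇒⇔ (cong₂ Consecutive (sym (toℕ-↑ʳ A t)) (sym (toℕ-↑ʳ A s))))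
  adj (inj₁ t) (inj₂ s) = across t s
  adj (inj₂ t) (inj₁ s) = ⇔-trans (mk⇔ swap swap) (⇔-trans (across s t) (mk⇔ Sum.swap Sum.swap))

module _ {p : ℕ} .{{_ : NonZero p}} where

  [t*p+r]%p≡r : ∀ t {r} → r < p → (t * p + r) % p ≡ r
  [t*p+r]%p≡r t {r} r<p = begin
    (t * p + r) % p  ≡⟨ %-congˡ (+-comm (t * p) r) ⟩
    (r + t * p) % p  ≡⟨ [m+kn]%n≡m%n r t p ⟩
    r % p            ≡⟨ m<n⇒m%n≡m r<p ⟩
    r                ∎
    where open ≡-Reasoning

  [t*p+r]/p≡t : ∀ t {r} → r < p → (t * p + r) / p ≡ t
  [t*p+r]/p≡t t {r} r<p = begin
    (t * p + r) / p    ≡⟨ /-congˡ (+-comm (t * p) r) ⟩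
    (r + t * p) / p    ≡⟨ +-distrib-/-∣ʳ r (n∣m*n t) ⟩
    r / p + t * p / p  ≡⟨ cong₂ _+_ (m<n⇒m/n≡0 r<p) (m*n/n≡m t p) ⟩
    t                  ∎
    where open ≡-Reasoning

  ≡[/p]*p+r : ∀ {i r} → i % p ≡ r → i ≡ i / p * p + r
  ≡[/p]*p+r {i} refl = trans (m≡m%n+[m/n]*n i p) (+-comm (i % p) (i / p * p))

  ≤/⇔*≤ : ∀ k m → k ≤ m / p ⇔ k * p ≤ m
  ≤/⇔*≤ k m = mk⇔ (λ k≤m/p → ≤-trans (*-monoˡ-≤ p k≤m/p) (m/n*n≤m m p))
                  (λ kp≤m → subst (_≤ m / p) (m*n/n≡m k p) (/-monoˡ-≤ p kp≤m))

  good[k*p]⇒k≡1 : ∀ {k} → Good p (k * p) → k ≡ 1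
  good[k*p]⇒k≡1 {k} g = *-cancelʳ-≡ k 1 p (trans (good-∣⇒≡ {p} g (n∣m*n k)) (sym (*-identityˡ p)))

  rayLength : ℕ → ℕ → ℕ
  rayLength r n = (n + (p ∸ r)) / p

  <rayLength⇔ : ∀ {r} n t → r ≤ p → t < rayLength r n ⇔ t * p + r ≤ n
  <rayLength⇔ {r} n t r≤p = ⇔-trans (≤/⇔*≤ (suc t) (n + (p ∸ r)))
    (mk⇔ (+-cancelʳ-≤ (p ∸ r) _ _ ∘ subst (_≤ n + (p ∸ r)) shift)
         (subst (_≤ n + (p ∸ r)) (sym shift) ∘ +-monoˡ-≤ (p ∸ r)))
    where
    shift : suc t * p ≡ t * p + r + (p ∸ r)
    shift = begin
      p + t * p              ≡⟨ +-comm p (t * p) ⟩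
      t * p + p              ≡⟨ cong (t * p +_) (sym (m+[n∸m]≡n r≤p)) ⟩
      t * p + (r + (p ∸ r))  ≡⟨ sym (+-assoc (t * p) r (p ∸ r)) ⟩
      t * p + r + (p ∸ r)    ∎
      where open ≡-Reasoning

module _ {p : ℕ} .{{_ : NonZero p}} (p-odd : p % 2 ≡ 1) where

  same-residue-adj : ∀ {r i j} → ¬ p ∣ 2 * r → i % p ≡ r → j % p ≡ r →
                     HalfAdj p i j ⇔ Consecutive (i / p) (j / p)
  same-residue-adj {r} {i} {j} p∤2r i≡r j≡r =
    ⇔-trans (≡⇒⇔ (cong₂ (HalfAdj p) (≡[/p]*p+r i≡r) (≡[/p]*p+r j≡r))) (mk⇔ consecutive adjacent)
    where
    t = i / p
    s = j / p
    diff : ∣ t * p + r - s * p + r ∣ ≡ ∣ t - s ∣ * p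
    diff = begin
      ∣ t * p + r - s * p + r ∣  ≡⟨ cong₂ ∣_-_∣ (+-comm (t * p) r) (+-comm (s * p) r) ⟩
      ∣ r + t * p - r + s * p ∣  ≡⟨ ∣m+n-m+o∣≡∣n-o∣ r (t * p) (s * p) ⟩
      ∣ t * p - s * p ∣          ≡⟨ sym (*-distribʳ-∣-∣ p t s) ⟩
      ∣ t - s ∣ * p              ∎
      where open ≡-Reasoning
    sum : (t * p + r) + (s * p + r) ≡ (t + s) * p + 2 * r
    sum = rearrange t s p r
      where
      rearrange : ∀ t s p r → (t * p + r) + (s * p + r) ≡ (t + s) * p + 2 * r
      rearrange = solve-∀
    consecutive : HalfAdj p (t * p + r) (s * p + r) → Consecutive t s
    consecutive (_ , _ , g) = to (∣-∣≡1⇔consecutive t s) (good[k*p]⇒k≡1 (subst (Good p) diff g))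
    adjacent : Consecutive t s → HalfAdj p (t * p + r) (s * p + r)
    adjacent c = halfAdj-intro odd (λ p∣sum → contradiction (p∣2r p∣sum) p∤2r) (λ _ → diff≡p)
      where
      p∣2r : p ∣ (t * p + r) + (s * p + r) → p ∣ 2 * r
      p∣2r p∣sum = ∣m+n∣m⇒∣n (subst (p ∣_) sum p∣sum) (n∣m*n (t + s))
      diff≡p : ∣ t * p + r - s * p + r ∣ ≡ p
      diff≡p = trans diff (trans (cong (_* p) (from (∣-∣≡1⇔consecutive t s) c)) (*-identityˡ p))
      odd : ((t * p + r) + (s * p + r)) % 2 ≡ 1
      odd = trans (sym (∣m-n∣%2≡[m+n]%2 (t * p + r) (s * p + r))) (trans (cong (_% 2) diff≡p) p-odd)

  opposite-residue-adj : ∀ {d c i j} → d + c ≡ p → HalfAdj p d c → i % p ≡ d → j % p ≡ c →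
                         HalfAdj p i j ⇔ (i / p ≡ 0 × j / p ≡ 0)
  opposite-residue-adj {d} {c} {i} {j} d+c≡p adj i≡d j≡c =
    ⇔-trans (≡⇒⇔ (cong₂ (HalfAdj p) (≡[/p]*p+r i≡d) (≡[/p]*p+r j≡c))) (mk⇔ roots adjacent)
    where
    t = i / p
    s = j / p
    sum : (t * p + d) + (s * p + c) ≡ suc (t + s) * p
    sum = begin
      (t * p + d) + (s * p + c)  ≡⟨ rearrange t s p d c ⟩
      (t + s) * p + (d + c)      ≡⟨ cong ((t + s) * p +_) d+c≡p ⟩
      (t + s) * p + p            ≡⟨ +-comm ((t + s) * p) p ⟩
      suc (t + s) * p            ∎
      where
      open ≡-Reasoning
      rearrange : ∀ t s p d c → (t * p + d) + (s * p + c) ≡ (t + s) * p + (d + c)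
      rearrange = solve-∀
    roots : HalfAdj p (t * p + d) (s * p + c) → t ≡ 0 × s ≡ 0
    roots (_ , g , _) = m+n≡0⇒m≡0 t t+s≡0 , m+n≡0⇒n≡0 t t+s≡0
      where
      t+s≡0 : t + s ≡ 0
      t+s≡0 = suc-injective (good[k*p]⇒k≡1 (subst (Good p) sum g))
    adjacent : t ≡ 0 × s ≡ 0 → HalfAdj p (t * p + d) (s * p + c)
    adjacent (t≡0 , s≡0) = subst₂ (λ a b → HalfAdj p (a * p + d) (b * p + c)) (sym t≡0) (sym s≡0) adj

-- The class ±c modulo p induces a path

module PlusMinusClass {p : ℕ} .{{_ : NonZero p}} (p-odd : p % 2 ≡ 1)
                      {c : ℕ} (0<c : 0 < c) (c<p : c < p) (p∤2c : ¬ p ∣ 2 * c) where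

  d : ℕ
  d = p ∸ c

  d+c≡p : d + c ≡ p
  d+c≡p = m∸n+n≡m (<⇒≤ c<p)

  0<d : 0 < d
  0<d = m<n⇒0<n∸m c<p

  d<p : d < p
  d<p = ∸-monoʳ-< 0<c (<⇒≤ c<p)

  d≢c : d ≢ c
  d≢c d≡c = contradiction (trans (sym p-odd) (trans (cong (_% 2) p≡c+c) ([m+m]%2≡0 c))) λ ()
    where
    p≡c+c : p ≡ c + c
    p≡c+c = trans (sym d+c≡p) (cong (_+ c) d≡c)

  p∤2d : ¬ p ∣ 2 * d
  p∤2d p∣2d = p∤2c (∣m+n∣m⇒∣n (subst (p ∣_) 2p≡2d+2c (n∣m*n 2)) p∣2d)
    where
    2p≡2d+2c : 2 * p ≡ 2 * d + 2 * c
    2p≡2d+2c = trans (cong (2 *_) (sym d+c≡p)) (*-distribˡ-+ 2 d c)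

  halfAdj-d-c : HalfAdj p d c
  halfAdj-d-c = halfAdj-intro (trans (cong (_% 2) d+c≡p) p-odd) (λ _ → d+c≡p)
                              (λ p∣diff → ⊥-elim (<⇒≱ diff<p (p≤diff p∣diff)))
    where
    diff<p : ∣ d - c ∣ < p
    diff<p = ≤-<-trans (∣m-n∣≤m⊔n d c) (⊔-lub d<p c<p)
    p≤diff : p ∣ ∣ d - c ∣ → p ≤ ∣ d - c ∣
    p≤diff p∣diff with ∣ d - c ∣ in eq
    ... | zero  = contradiction (∣m-n∣≡0⇒m≡n eq) d≢c
    ... | suc _ = ∣⇒≤ p∣diff

  module _ (n : ℕ) where
    open VertexSet n

    module Ray {r} (0<r : 0 < r) (r<p : r < p) where

      index : (x : GV n) → half x % p ≡ r → Fin (rayLength r n)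
      index x x≡r =
        fromℕ< (from (<rayLength⇔ n (half x / p) (<⇒≤ r<p)) (subst (_≤ n) (≡[/p]*p+r x≡r) (half≤n x)))

      vertexAt : Fin (rayLength r n) → GV n
      vertexAt t = vertex (toℕ t * p + r) (≤-trans 0<r (m≤n+m r _)) (to (<rayLength⇔ n (toℕ t) (<⇒≤ r<p)) (toℕ<n t))

      half-vertexAt : ∀ t → half (vertexAt t) ≡ toℕ t * p + r
      half-vertexAt t = ⌊2*n/2⌋≡n (toℕ t * p + r)

      toℕ-index : ∀ x x≡r → toℕ (index x x≡r) ≡ half x / p
      toℕ-index x x≡r = toℕ-fromℕ< _

      vertexAt-% : ∀ t → half (vertexAt t) % p ≡ r
      vertexAt-% t = trans (cong (_% p) (half-vertexAt t)) ([t*p+r]%p≡r (toℕ t) r<p)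

      vertexAt-index : ∀ x x≡r → vertexAt (index x x≡r) ≡ x
      vertexAt-index x x≡r = half-injective (begin
        half (vertexAt (index x x≡r))  ≡⟨ half-vertexAt (index x x≡r) ⟩
        toℕ (index x x≡r) * p + r      ≡⟨ cong (λ t → t * p + r) (toℕ-index x x≡r) ⟩
        half x / p * p + r             ≡⟨ sym (≡[/p]*p+r x≡r) ⟩
        half x                         ∎)
        where open ≡-Reasoning

      index-vertexAt : ∀ t e → index (vertexAt t) e ≡ t
      index-vertexAt t e = toℕ-injective (begin
        toℕ (index (vertexAt t) e)  ≡⟨ toℕ-index (vertexAt t) e ⟩
        half (vertexAt t) / p       ≡⟨ cong (_/ p) (half-vertexAt t) ⟩
        (toℕ t * p + r) / p         ≡⟨ [t*p+r]/p≡t (toℕ t) r<p ⟩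
        toℕ t                       ∎)
        where open ≡-Reasoning

    module D = Ray 0<d d<p
    module C = Ray 0<c c<p

    Class : GV n → Set
    Class x = half x % p ≡ d ⊎ half x % p ≡ c

    module _ (S : GV n → Set) (S⇔Class : ∀ x → S x ⇔ Class x) (S-irrelevant : ∀ {x} (a b : S x) → a ≡ b) where

      place : (x : GV n) → Class x → Fin (rayLength d n) ⊎ Fin (rayLength c n)
      place x = Sum.map (D.index x) (C.index x)

      unplace : Fin (rayLength d n) ⊎ Fin (rayLength c n) → Σ (GV n) S
      unplace (inj₁ t) = D.vertexAt t , from (S⇔Class _) (inj₁ (D.vertexAt-% t))
      unplace (inj₂ t) = C.vertexAt t , from (S⇔Class _) (inj₂ (C.vertexAt-% t))

      Σ-≡ : ∀ {x y} {a : S x} {b : S y} → x ≡ y → (x , a) ≡ (y , b)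
      Σ-≡ {x} {a = a} {b} refl = cong (x ,_) (S-irrelevant a b)

      unplace-place : ∀ x (m : Class x) (s : S x) → unplace (place x m) ≡ (x , s)
      unplace-place x (inj₁ e) s = Σ-≡ (D.vertexAt-index x e)
      unplace-place x (inj₂ e) s = Σ-≡ (C.vertexAt-index x e)

      place-unplace : ∀ u (m : Class (proj₁ (unplace u))) → place (proj₁ (unplace u)) m ≡ u
      place-unplace (inj₁ t) (inj₁ e) = cong inj₁ (D.index-vertexAt t e)
      place-unplace (inj₁ t) (inj₂ e) = contradiction (trans (sym (D.vertexAt-% t)) e) d≢c
      place-unplace (inj₂ t) (inj₁ e) = contradiction (trans (sym e) (C.vertexAt-% t)) d≢c
      place-unplace (inj₂ t) (inj₂ e) = cong inj₂ (C.index-vertexAt t e)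

      place-adj : ∀ x y (mx : Class x) (my : Class y) →
                  HalfAdj p (half x) (half y) ⇔ RaysE (place x mx) (place y my)
      place-adj x y (inj₁ ex) (inj₁ ey) = ⇔-trans (same-residue-adj p-odd p∤2d ex ey)
        (≡⇒⇔ (cong₂ Consecutive (sym (D.toℕ-index x ex)) (sym (D.toℕ-index y ey))))
      place-adj x y (inj₂ ex) (inj₂ ey) = ⇔-trans (same-residue-adj p-odd p∤2c ex ey)
        (≡⇒⇔ (cong₂ Consecutive (sym (C.toℕ-index x ex)) (sym (C.toℕ-index y ey))))
      place-adj x y (inj₁ ex) (inj₂ ey) = ⇔-trans (opposite-residue-adj p-odd d+c≡p halfAdj-d-c ex ey)
        (≡⇒⇔ (cong₂ (λ a b → a ≡ 0 × b ≡ 0) (sym (D.toℕ-index x ex)) (sym (C.toℕ-index y ey))))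
      place-adj x y (inj₂ ex) (inj₁ ey) = ⇔-trans (mk⇔ (halfAdj-sym {p}) (halfAdj-sym {p}))
        (⇔-trans (opposite-residue-adj p-odd d+c≡p halfAdj-d-c ey ex)
          (⇔-trans (mk⇔ swap swap)
            (≡⇒⇔ (cong₂ (λ a b → a ≡ 0 × b ≡ 0) (sym (C.toℕ-index x ex)) (sym (D.toℕ-index y ey))))))

      class≅rays : Induced (G p n) S ≅ Rays (rayLength d n) (rayLength c n)
      class≅rays = record
        { to      = λ (x , s) → place x (class x s)
        ; from    = unplace
        ; from∘to = λ (x , s) → unplace-place x (class x s) s
        ; to∘from = λ u → place-unplace u (class _ (proj₂ (unplace u)))
        ; adj     = λ (x , s) (y , t) → ⇔-trans (Adj⇔HalfAdj p x y) (place-adj x y (class x s) (class y t))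
        }
        where
        class : ∀ x → S x → Class x
        class x = to (S⇔Class x)

      classInducesPath : c ≤ n → InducesPath (G p n) S
      classInducesPath c≤n =
        rayLength d n + rayLength c n ,
        ≤-trans (from (<rayLength⇔ n 0 (<⇒≤ c<p)) c≤n) (m≤n+m _ _) ,
        ≅-trans class≅rays (rays≅path _ _)

-- G(5, n) for n ≥ 10

halfAdj-coprime : ∀ {p i j} → ¬ p ∣ i + j → ¬ p ∣ ∣ i - j ∣ → HalfAdj p i j ⇔ (i + j) % 2 ≡ 1
halfAdj-coprime p∤sum p∤diff = mk⇔ (λ (_ , g , _) → proj₁ g)
  (λ odd → halfAdj-intro odd (λ p∣sum → contradiction p∣sum p∤sum) (λ p∣diff → contradiction p∣diff p∤diff))

multiples-nonadjacent : ∀ {p i j} → p ∣ i → p ∣ j → 0 < i → 0 < j → ¬ HalfAdj p i j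
multiples-nonadjacent {p} {i} {j} p∣i p∣j 0<i 0<j (_ , g , _) = <⇒≱ 0<j (+-cancelˡ-≤ i j 0 i+j≤i+0)
  where
  i+j≡p : i + j ≡ p
  i+j≡p = good-∣⇒≡ {p} g (∣m∣n⇒∣m+n p∣i p∣j)
  i+j≤i+0 : i + j ≤ i + 0
  i+j≤i+0 = subst₂ _≤_ (sym i+j≡p) (sym (+-identityʳ i)) (∣⇒≤ {{>-nonZero 0<i}} p∣i)

∣-∣-divisible⇒%≡ : ∀ {p} .{{_ : NonZero p}} i j → p ∣ ∣ i - j ∣ → i % p ≡ j % p
∣-∣-divisible⇒%≡ {p} i j p∣diff with ≤-total i j
... | inj₁ i≤j = sym (trans (cong (_% p) (sym (m+[n∸m]≡n i≤j)))
                            (%-remove-+ʳ i (subst (p ∣_) (m≤n⇒∣m-n∣≡n∸m i≤j) p∣diff)))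
... | inj₂ j≤i = trans (cong (_% p) (sym (m+[n∸m]≡n j≤i)))
                       (%-remove-+ʳ j (subst (p ∣_) (m≤n⇒∣n-m∣≡n∸m j≤i) p∣diff))

small-multiple : ∀ {p m} .{{_ : NonZero p}} → m < 2 * p → m % p ≡ 0 → m ≡ 0 ⊎ m ≡ p
small-multiple {p} {m} m<2p m%p≡0 with m / p | m<n*o⇒m/o<n {m} {2} {p} m<2p | ≡[/p]*p+r {p} {m} m%p≡0
... | 0           | _            | m≡0   = inj₁ m≡0
... | 1           | _            | m≡1*p = inj₂ (trans m≡1*p (trans (+-identityʳ (1 * p)) (*-identityˡ p)))
... | suc (suc _) | s≤s (s≤s ()) | _

classOf : ℕ → Part
classOf 0 = partI
classOf 1 = partQ1
classOf 2 = partQ2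
classOf 3 = partQ2
classOf 4 = partQ1
classOf _ = partI

classOf≡I : ∀ {r} → r < 5 → classOf r ≡ partI → r ≡ 0
classOf≡I {0} _ _ = refl
classOf≡I {1} _ ()
classOf≡I {2} _ ()
classOf≡I {3} _ ()
classOf≡I {4} _ ()
classOf≡I {suc (suc (suc (suc (suc _))))} (s≤s (s≤s (s≤s (s≤s (s≤s ()))))) _

classOf≡Q1⇔ : ∀ r → classOf r ≡ partQ1 ⇔ (r ≡ 1 ⊎ r ≡ 4)
classOf≡Q1⇔ r = mk⇔ (residue r) λ { (inj₁ refl) → refl ; (inj₂ refl) → refl }
  where
  residue : ∀ r → classOf r ≡ partQ1 → r ≡ 1 ⊎ r ≡ 4
  residue 1 _ = inj₁ refl
  residue 4 _ = inj₂ refl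
  residue 0 ()
  residue 2 ()
  residue 3 ()
  residue (suc (suc (suc (suc (suc _))))) ()

classOf≡Q2⇔ : ∀ r → classOf r ≡ partQ2 ⇔ (r ≡ 2 ⊎ r ≡ 3)
classOf≡Q2⇔ r = mk⇔ (residue r) λ { (inj₁ refl) → refl ; (inj₂ refl) → refl }
  where
  residue : ∀ r → classOf r ≡ partQ2 → r ≡ 2 ⊎ r ≡ 3
  residue 2 _ = inj₁ refl
  residue 3 _ = inj₂ refl
  residue 0 ()
  residue 1 ()
  residue 4 ()
  residue (suc (suc (suc (suc (suc _))))) ()

classOf-complement : ∀ r {s} → r + s ≡ 5 → classOf r ≡ classOf s
classOf-complement 0 refl = refl
classOf-complement 1 refl = refl
classOf-complement 2 refl = refl
classOf-complement 3 refl = refl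
classOf-complement 4 refl = refl
classOf-complement 5 refl = refl
classOf-complement (suc (suc (suc (suc (suc (suc _)))))) ()

classOf-± : ∀ i j → 5 ∣ i + j ⊎ 5 ∣ ∣ i - j ∣ → classOf (i % 5) ≡ classOf (j % 5)
classOf-± i j (inj₂ 5∣diff) = cong classOf (∣-∣-divisible⇒%≡ i j 5∣diff)
classOf-± i j (inj₁ 5∣sum) with small-multiple {5} {i % 5 + j % 5} residues<10 residues%5≡0
  where
  residues<10 : i % 5 + j % 5 < 10
  residues<10 = +-mono-< (m%n<n i 5) (m%n<n j 5)
  residues%5≡0 : (i % 5 + j % 5) % 5 ≡ 0
  residues%5≡0 = trans (sym (%-distribˡ-+ i j 5)) (n∣m⇒m%n≡0 _ 5 5∣sum)
... | inj₁ sum≡0 = cong classOf (trans (m+n≡0⇒m≡0 (i % 5) sum≡0) (sym (m+n≡0⇒n≡0 (i % 5) sum≡0)))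
... | inj₂ sum≡5 = classOf-complement (i % 5) sum≡5

G5-structure : ∀ n → 10 ≤ n → Structure n
G5-structure n 10≤n = bipartite , label , independent , pathQ1 , pathQ2 , crossing
  where
  open VertexSet n

  label : GV n → Part
  label x = classOf (half x % 5)

  bipartite : ∀ x y → Adj 5 (proj₁ x) (proj₁ y) → Opposite n x y
  bipartite x y a = from (Opposite⇔odd x y) (proj₁ (proj₁ (proj₂ (to (Adj⇔HalfAdj 5 x y) a))))

  multiple : ∀ x → label x ≡ partI → 5 ∣ half x
  multiple x lx = m%n≡0⇒n∣m _ 5 (classOf≡I (m%n<n (half x) 5) lx)

  independent : ∀ x y → label x ≡ partI → label y ≡ partI → ¬ Adj 5 (proj₁ x) (proj₁ y)
  independent x y lx ly a =
    multiples-nonadjacent (multiple x lx) (multiple y ly) (half-pos x) (half-pos y) (to (Adj⇔HalfAdj 5 x y) a)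

  pathQ1 : InducesPath (G 5 n) (λ x → label x ≡ partQ1)
  pathQ1 = PlusMinusClass.classInducesPath {5} refl {4} z<s (n<1+n 4) (from-no (5 ∣? 8))
             n _ (λ x → classOf≡Q1⇔ (half x % 5)) (λ a b → uip a b) (≤-trans (m≤m+n 4 6) 10≤n)

  pathQ2 : InducesPath (G 5 n) (λ x → label x ≡ partQ2)
  pathQ2 = PlusMinusClass.classInducesPath {5} refl {3} z<s (m<n+m 3 {2} z<s) (from-no (5 ∣? 6))
             n _ (λ x → classOf≡Q2⇔ (half x % 5)) (λ a b → uip a b) (≤-trans (m≤m+n 3 7) 10≤n)

  crossing : ∀ x y → label x ≢ label y → Adj 5 (proj₁ x) (proj₁ y) ⇔ Opposite n x y
  crossing x y lx≢ly = ⇔-trans (Adj⇔HalfAdj 5 x y)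
    (⇔-trans (halfAdj-coprime (lx≢ly ∘ classOf-± (half x) (half y) ∘ inj₁)
                              (lx≢ly ∘ classOf-± (half x) (half y) ∘ inj₂))
             (⇔-sym (Opposite⇔odd x y)))

-- G(5, n) for n ≤ 9

-- Index i, i.e. the vertex 2i + 2, goes to the second summand iff i is even, i.e. iff 2i + 2 ∈ Y.
byParity : ∀ n → Fin n ↔ (Fin ⌊ n /2⌋ ⊎ Fin ⌈ n /2⌉)
byParity n = mk↔ₛ′ (split n) (merge n) (split-merge n) (merge-split n)
  where
  split : ∀ n → Fin n → Fin ⌊ n /2⌋ ⊎ Fin ⌈ n /2⌉
  split (suc n) Fin.zero    = inj₂ Fin.zero
  split (suc n) (Fin.suc i) = Sum.[ inj₂ ∘ Fin.suc , inj₁ ]′ (split n i)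
  merge : ∀ n → Fin ⌊ n /2⌋ ⊎ Fin ⌈ n /2⌉ → Fin n
  merge zero    (inj₁ ())
  merge zero    (inj₂ ())
  merge (suc n) (inj₁ b)           = Fin.suc (merge n (inj₂ b))
  merge (suc n) (inj₂ Fin.zero)    = Fin.zero
  merge (suc n) (inj₂ (Fin.suc a)) = Fin.suc (merge n (inj₁ a))
  merge-split : ∀ n i → merge n (split n i) ≡ i
  merge-split (suc n) Fin.zero = refl
  merge-split (suc n) (Fin.suc i) with split n i | merge-split n i
  ... | inj₁ _ | e = cong Fin.suc e
  ... | inj₂ _ | e = cong Fin.suc e
  split-merge : ∀ n u → split n (merge n u) ≡ u
  split-merge zero    (inj₁ ())
  split-merge zero    (inj₂ ())
  split-merge (suc n) (inj₁ b)           rewrite split-merge n (inj₂ b) = refl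
  split-merge (suc n) (inj₂ Fin.zero)    = refl
  split-merge (suc n) (inj₂ (Fin.suc a)) rewrite split-merge n (inj₁ a) = refl

_⇔?_ : ∀ {A B : Set} → Dec A → Dec B → Dec (A ⇔ B)
a? ⇔? b? = map (mk⇔ (λ (f , g) → mk⇔ f g) (λ e → to e , from e)) ((a? →-dec b?) ×-dec (b? →-dec a?))

module _ (p : ℕ) {n : ℕ} (H : Graph) (e : Fin n ↔ V H) (E? : ∀ u w → Dec (E H u w)) where

  AgreesWith : Fin n → Fin n → Set
  AgreesWith i j = HalfAdj p (suc (toℕ i)) (suc (toℕ j)) ⇔ E H (Inverse.to e i) (Inverse.to e j)

  agreesWith? : Dec (∀ i j → AgreesWith i j)
  agreesWith? = all? λ i → all? λ j →
    halfAdj? p (suc (toℕ i)) (suc (toℕ j)) ⇔? E? (Inverse.to e i) (Inverse.to e j)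

  ≅-byComputation : True agreesWith? → G p n ≅ H
  ≅-byComputation agree = relabel (↔-trans vertices↔Fin e) adj
    where
    open VertexSet n
    adj : ∀ x y → Adj p (proj₁ x) (proj₁ y) ⇔ E H _ _
    adj x y = ⇔-trans (Adj⇔HalfAdj p x y)
      (⇔-trans (≡⇒⇔ (cong₂ (HalfAdj p) (sym (suc-toℕ-vertexIndex x)) (sym (suc-toℕ-vertexIndex y))))
               (toWitness agree (vertexIndex x) (vertexIndex y)))

consecutive? : ∀ m n → Dec (Consecutive m n)
consecutive? m n = (suc m ≟ n) ⊎-dec (suc n ≟ m)

KBipE? : ∀ r s (u w : Fin r ⊎ Fin s) → Dec (KBipE r s u w)
KBipE? r s (inj₁ _) (inj₁ _) = no λ ()
KBipE? r s (inj₁ _) (inj₂ _) = yes tt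
KBipE? r s (inj₂ _) (inj₁ _) = yes tt
KBipE? r s (inj₂ _) (inj₂ _) = no λ ()

isEdgeIJ? : ∀ {r s} (i : Fin r) (j : Fin s) u w → Dec (IsEdgeIJ i j u w)
isEdgeIJ? i j u w = (u ≟⊎ inj₁ i ×-dec w ≟⊎ inj₂ j) ⊎-dec (u ≟⊎ inj₂ j ×-dec w ≟⊎ inj₁ i)
  where
  _≟⊎_ : ∀ {r s} → DecidableEquality (Fin r ⊎ Fin s)
  _≟⊎_ = ≡-dec Fin._≟_ Fin._≟_

theorem5p2 : (∀ (n : ℕ) → 10 ≤ n → Structure n)
    × (G 5 1 ≅ K1)
    × (G 5 2 ≅ K2)
    × (G 5 3 ≅ Path 3)
    × (G 5 4 ≅ C4)
    × (G 5 5 ≅ KBip 2 3)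
    × (G 5 6 ≅ KBip 3 3)
    × (G 5 7 ≅ KBip 3 4)
    × (Σ (Fin 4) λ i → Σ (Fin 4) λ j → G 5 8 ≅ KBipMinus1 4 4 i j)
    × (Σ (Fin 4) λ i₁ → Σ (Fin 5) λ j₁ → Σ (Fin 4) λ i₂ → Σ (Fin 5) λ j₂ →
    (i₁ ≢ i₂) × (j₁ ≢ j₂) × (G 5 9 ≅ KBipMinus2 4 5 i₁ j₁ i₂ j₂))
theorem5p2 =
    G5-structure
  , ≅-byComputation 5 K1 ↔-refl (λ _ _ → no λ ()) _
  , ≅-byComputation 5 K2 ↔-refl (λ u w → ¬? (u Fin.≟ w)) _
  , ≅-byComputation 5 (Path 3) ↔-refl (λ u w → consecutive? (toℕ u) (toℕ w)) _
  , ≅-byComputation 5 C4 ↔-refl (λ u w → (suc (toℕ u) % 4 ≟ toℕ w) ⊎-dec (suc (toℕ w) % 4 ≟ toℕ u)) _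
  , ≅-byComputation 5 (KBip 2 3) (byParity 5) (KBipE? 2 3) _
  , ≅-byComputation 5 (KBip 3 3) (byParity 6) (KBipE? 3 3) _
  , ≅-byComputation 5 (KBip 3 4) (byParity 7) (KBipE? 3 4) _
  -- Below n = 10 the only missing edges between X and Y join halves with sum 15: {7, 8} and {6, 9}.
  , (# 3 , # 3 , ≅-byComputation 5 (KBipMinus1 4 4 (# 3) (# 3)) (byParity 8)
                   (λ u w → KBipE? 4 4 u w ×-dec ¬? (isEdgeIJ? (# 3) (# 3) u w)) _)
  , (# 2 , # 4 , # 3 , # 3 , (λ ()) , (λ ()) ,
     ≅-byComputation 5 (KBipMinus2 4 5 (# 2) (# 4) (# 3) (# 3)) (byParity 9)
       (λ u w → KBipE? 4 5 u w ×-dec ¬? (isEdgeIJ? (# 2) (# 4) u w) ×-dec ¬? (isEdgeIJ? (# 3) (# 3) u w)) _)
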